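{- Let $\mathcal M=(U,\mathcal L)$ be an oriented matroid of rank $d$ with tope graph $G(\mathcal M)$. For any tope $T$ of $\mathcal M$, the set $\mathrm{osc}(T)$ contains a subset $D$ of size $d$ that is shattered by $\mathcal M$.
   Context: Sign vectors, composition $\circ$, $\mathrm{Sep}$ and $\le$ (product order with $0\le -1,+1$) as usual. An oriented matroid (OM) is $\mathcal M=(U,\mathcal L)$, $\mathcal L\subseteq\{ -1,0,+1\}^U$, containing $\mathbf 0$, closed under composition and negation, satisfying strong elimination (for $X,Y\in\mathcal L$ and $e\in\mathrm{Sep}(X,Y)$ some $Z\in\mathcal L$ has $Z_e=0$ and $Z_f=(X\circ Y)_f$ for $f\notin\mathrm{Sep}(X,Y)$), and simple (each coordinate takes all values, and for $e\ne f$ there are $X,Y\in\mathcal L$ with $\{X_eX_f,Y_eY_f\}=\{+1,-1\}$). The rank of $\mathcal M$ is the length of a maximal chain of the poset $(\mathcal L\cup\{\hat 1\},\le)$ ($\hat1$ an added maximum) minus one. Topes are the maximal elements of $(\mathcal L,\le)$; the tope graph $G(\mathcal M)$ has the topes as vertices, adjacent iff they differ in exactly one coordinate. For a tope $T$, $\mathrm{osc}(T)$ is the set of $e\in U$ such that $T$ is incident in $G(\mathcal M)$ to an edge whose endpoints differ in coordinate $e$. $D$ is shattered by $\mathcal M$ if for every $Z\in\{\pm1\}^D$ some tope restricts to $Z$ on $D$. -}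

module Defs where

open import Data.Nat using (ℕ; _∸_)
open import Data.Fin using (Fin)
open import Data.Fin.Subset using (Subset; _∈_; _∉_; ∣_∣)
open import Data.Vec using (Vec; lookup; zipWith; map; replicate)
open import Data.List using (List; length)
open import Data.List.Relation.Unary.All using (All)
open import Data.List.Relation.Unary.Linked using (Linked)
import Data.List.Membership.Propositional as LM
open import Data.Maybe using (Maybe; just; nothing)
open import Data.Bool using (Bool; true; false)
open import Data.Product using (Σ; ∃; _×_; _,_)
open import Relation.Binary.PropositionalEquality using (_≡_; _≢_)
open import Relation.Nullary using (¬_)
open import Data.Unit using (⊤)
open import Data.Empty using (⊥)

data Sign : Set where
  neg zer pos : Sign

_·_ : Sign → Sign → Sign
zer · _   = zer
_   · zer = zer
pos · pos = pos
neg · neg = pos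
pos · neg = neg
neg · pos = neg

opp : Sign → Sign
opp neg = pos
opp zer = zer
opp pos = neg

_∘s_ : Sign → Sign → Sign
zer ∘s y = y
x   ∘s _ = x

data _≤s_ : Sign → Sign → Set where
  z≤ : ∀ {s} → zer ≤s s
  refl≤ : ∀ {s} → s ≤s s

SignVec : ℕ → Set
SignVec n = Vec Sign n

module _ {n : ℕ} where

  𝟎 : SignVec n
  𝟎 = replicate n zer

  _∘_ : SignVec n → SignVec n → SignVec n
  X ∘ Y = zipWith _∘s_ X Y

  -_ : SignVec n → SignVec n
  - X = map opp X

  InSep : SignVec n → SignVec n → Fin n → Set
  InSep X Y e = (lookup X e ≢ zer) × (lookup X e ≡ opp (lookup Y e))

  _≤_ : SignVec n → SignVec n → Set
  X ≤ Y = ∀ e → lookup X e ≤s lookup Y e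

  _<_ : SignVec n → SignVec n → Set
  X < Y = (X ≤ Y) × (X ≢ Y)

-- Oriented matroid (given by its covectors) on ground set Fin n
record IsOM (n : ℕ) (L : SignVec n → Set) : Set where
  field
    zero∈ : L 𝟎
    comp∈ : ∀ X Y → L X → L Y → L (X ∘ Y)
    neg∈  : ∀ X → L X → L (- X)
    strongElim : ∀ X Y → L X → L Y → ∀ e → InSep X Y e →
      Σ (SignVec n) λ Z → L Z × (lookup Z e ≡ zer) ×
        (∀ f → ¬ InSep X Y f → lookup Z f ≡ lookup (X ∘ Y) f)
    -- simplicity
    allValues : ∀ (e : Fin n) (s : Sign) → Σ (SignVec n) λ X → L X × (lookup X e ≡ s)
    distinct : ∀ (e f : Fin n) → e ≢ f →
      Σ (SignVec n) λ X → Σ (SignVec n) λ Y → L X × L Y ×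
        (lookup X e · lookup X f ≡ pos) × (lookup Y e · lookup Y f ≡ neg)

module _ {n : ℕ} (L : SignVec n → Set) where

  -- the poset L ∪ {1̂}: nothing plays the role of 1̂
  InPoset : Maybe (SignVec n) → Set
  InPoset (just X) = L X
  InPoset nothing  = ⊤

  _<̂_ : Maybe (SignVec n) → Maybe (SignVec n) → Set
  just X <̂ just Y = X < Y
  just X <̂ nothing = ⊤
  nothing <̂ _ = ⊥

  IsChain : List (Maybe (SignVec n)) → Set
  IsChain c = All InPoset c × Linked _<̂_ c

  IsMaximalChain : List (Maybe (SignVec n)) → Set
  IsMaximalChain c = IsChain c ×
    (∀ c' → IsChain c' → (∀ {x} → x LM.∈ c → x LM.∈ c') → (∀ {x} → x LM.∈ c' → x LM.∈ c))

  -- rank d : a maximal chain of L ∪ {1̂} has length (#elements - 1) equal to d + 1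
  HasRank : ℕ → Set
  HasRank d = Σ (List (Maybe (SignVec n))) λ c → IsMaximalChain c × (length c ∸ 1 ∸ 1 ≡ d)

  IsTope : SignVec n → Set
  IsTope T = L T × (∀ X → L X → T ≤ X → X ≡ T)

  -- e ∈ osc(T): T adjacent in the tope graph to a tope differing exactly in coordinate e
  InOsc : SignVec n → Fin n → Set
  InOsc T e = Σ (SignVec n) λ T' → IsTope T' × (lookup T e ≢ lookup T' e) ×
    (∀ f → f ≢ e → lookup T f ≡ lookup T' f)

  toSign : Bool → Sign
  toSign true = pos
  toSign false = neg

  Shattered : Subset n → Set
  Shattered D = ∀ (Z : Fin n → Bool) →
    Σ (SignVec n) λ T → IsTope T × (∀ e → e ∈ D → lookup T e ≡ toSign (Z e))

-- The rank gives a chain X₀ < X₁ < ⋯ < X_d of covectors, hence a triangular family: Yᵢ = Xᵢ has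
-- a pivot in its support outside the supports of Y₁, …, Yᵢ₋₁. Every nonzero covector Y meets
-- osc(T) inside its support: walking in the tope graph from T towards the tope ±Y ∘ T ≠ T, the
-- first edge crosses a coordinate where Y is nonzero. Pick such b₁ for Y₁ and eliminate b₁ from
-- Y₂, …, Y_d against Y₁, keeping the zeros of Y₁; the result is triangular of length d - 1 and
-- vanishes at b₁. Recursively this yields D = {b₁, …, b_d} ⊆ osc(T), and composing the members,
-- each with a suitable sign and later ones first, followed by T realises every sign pattern on D.
module Submission where

open import Defs
open import Data.Nat using (ℕ; zero; suc; _∸_; z<s; s<s)
open import Data.Fin using (Fin; zero; suc) renaming (_<_ to _<ᶠ_; _≟_ to _≟ᶠ_)
open import Data.Fin.Properties using (all?; any?; ¬∀⟶∃¬)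
open import Data.Fin.Subset using (Subset; _∈_; _∉_; ∣_∣; _⊂_; _⊆_; _∪_; ⁅_⁆; Nonempty; inside; outside)
  renaming (⊥ to ∅)
open import Data.Fin.Subset.Properties using (∉⊥; ∣⊥∣≡0; ∪-identityʳ; x∈p∪q⁻; x∈⁅y⁆⇒x≡y)
open import Data.Fin.Subset.Induction using (Acc; acc; ⊂-wellFounded)
open import Data.Vec using (_∷_; lookup; tabulate; here; there)
open import Data.Vec.Properties
  using (lookup-zipWith; lookup-map; lookup-replicate; lookup∘tabulate; tabulate∘lookup; tabulate-cong;
         []=⇒lookup; lookup⇒[]=)
import Data.Vec.Functional as Vector
open import Data.List using ([]; _∷_; length)
open import Data.List.Relation.Unary.All using (All; []; _∷_)
open import Data.List.Relation.Unary.Linked using (Linked; []; _∷_)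
open import Data.Maybe using (just; nothing)
open import Data.Bool using (Bool; true; false)
open import Data.Product using (Σ; ∃; _×_; _,_; proj₁; proj₂)
open import Data.Sum using (_⊎_; inj₁; inj₂; [_,_]′)
open import Relation.Binary.Definitions using (DecidableEquality)
open import Relation.Binary.PropositionalEquality
  using (_≡_; _≢_; refl; sym; trans; cong; subst; module ≡-Reasoning)
open import Relation.Nullary using (¬_; yes; no; ¬?; contradiction)
open import Relation.Nullary.Decidable using (isNo; _×-dec_)

private
  variable
    n : ℕ
    x y z t : Sign
    X Y Z : SignVec n
    e f : Fin n

_≟ˢ_ : DecidableEquality Sign
neg ≟ˢ neg = yes refl
neg ≟ˢ zer = no λ ()
neg ≟ˢ pos = no λ ()
zer ≟ˢ neg = no λ ()
zer ≟ˢ zer = yes refl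
zer ≟ˢ pos = no λ ()
pos ≟ˢ neg = no λ ()
pos ≟ˢ zer = no λ ()
pos ≟ˢ pos = yes refl

opp-involutive : opp (opp x) ≡ x
opp-involutive {neg} = refl
opp-involutive {zer} = refl
opp-involutive {pos} = refl

opp≢zer : x ≢ zer → opp x ≢ zer
opp≢zer {neg} _ ()
opp≢zer {pos} _ ()
opp≢zer {zer} x≢0 = x≢0

≢opp : x ≢ zer → x ≢ opp x
≢opp {neg} _ ()
≢opp {pos} _ ()
≢opp {zer} x≢0 = contradiction refl x≢0

align : x ≢ zer → t ≢ zer → x ≡ t ⊎ opp x ≡ t
align {neg} {neg} _ _ = inj₁ refl
align {neg} {pos} _ _ = inj₂ refl
align {pos} {neg} _ _ = inj₂ refl
align {pos} {pos} _ _ = inj₁ refl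
align {zer} x≢0 _ = contradiction refl x≢0
align {_} {zer} _ t≢0 = contradiction refl t≢0

∘ˢ-nonzeroˡ : x ≢ zer → x ∘s y ≡ x
∘ˢ-nonzeroˡ {neg} _ = refl
∘ˢ-nonzeroˡ {pos} _ = refl
∘ˢ-nonzeroˡ {zer} x≢0 = contradiction refl x≢0

∘ˢ-identityʳ : x ∘s zer ≡ x
∘ˢ-identityʳ {neg} = refl
∘ˢ-identityʳ {zer} = refl
∘ˢ-identityʳ {pos} = refl

∘ˢ≢zer : y ≢ zer → x ∘s y ≢ zer
∘ˢ≢zer {x = neg} _ ()
∘ˢ≢zer {x = pos} _ ()
∘ˢ≢zer {x = zer} y≢0 = y≢0

≤ˢ-∘ˢ : x ≤s (x ∘s y)
≤ˢ-∘ˢ {neg} = refl≤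
≤ˢ-∘ˢ {zer} = z≤
≤ˢ-∘ˢ {pos} = refl≤

≤ˢ-nonzero : x ≢ zer → x ≤s y → y ≡ x
≤ˢ-nonzero x≢0 z≤ = contradiction refl x≢0
≤ˢ-nonzero _ refl≤ = refl

≤ˢ-zero : x ≤s y → y ≡ zer → x ≡ zer
≤ˢ-zero z≤ _ = refl
≤ˢ-zero refl≤ y≡0 = y≡0

≤ˢ-≢ : x ≤s y → x ≢ y → x ≡ zer
≤ˢ-≢ z≤ _ = refl
≤ˢ-≢ refl≤ x≢y = contradiction refl x≢y

·≢zer : x ≢ zer → y ≢ zer → x · y ≢ zer
·≢zer {neg} {neg} _ _ ()
·≢zer {neg} {pos} _ _ ()
·≢zer {pos} {neg} _ _ ()
·≢zer {pos} {pos} _ _ ()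
·≢zer {zer} x≢0 _ = contradiction refl x≢0
·≢zer {_} {zer} _ y≢0 = contradiction refl y≢0

·≢zerˡ : x · y ≢ zer → x ≢ zer
·≢zerˡ {zer} xy≢0 = contradiction refl xy≢0
·≢zerˡ {neg} _ ()
·≢zerˡ {pos} _ ()

opp-·-opp : opp x · opp y ≡ x · y
opp-·-opp {neg} {neg} = refl
opp-·-opp {neg} {zer} = refl
opp-·-opp {neg} {pos} = refl
opp-·-opp {zer} = refl
opp-·-opp {pos} {neg} = refl
opp-·-opp {pos} {zer} = refl
opp-·-opp {pos} {pos} = refl

·-involutiveˡ : x ≢ zer → x · (x · y) ≡ y
·-involutiveˡ {neg} {neg} _ = refl
·-involutiveˡ {neg} {zer} _ = refl
·-involutiveˡ {neg} {pos} _ = refl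
·-involutiveˡ {pos} {neg} _ = refl
·-involutiveˡ {pos} {zer} _ = refl
·-involutiveˡ {pos} {pos} _ = refl
·-involutiveˡ {zer} x≢0 = contradiction refl x≢0

·-cancelˡ : x ≢ zer → x · y ≡ x · z → y ≡ z
·-cancelˡ {x} {y} {z} x≢0 xy≡xz = begin
  y            ≡⟨ sym (·-involutiveˡ x≢0) ⟩
  x · (x · y)  ≡⟨ cong (x ·_) xy≡xz ⟩
  x · (x · z)  ≡⟨ ·-involutiveˡ x≢0 ⟩
  z            ∎
  where open ≡-Reasoning

lookup-∘ : ∀ (X Y : SignVec n) e → lookup (X ∘ Y) e ≡ lookup X e ∘s lookup Y e
lookup-∘ X Y e = lookup-zipWith _∘s_ e X Y

lookup-∘-zeroˡ : ∀ (X Y : SignVec n) → lookup X e ≡ zer → lookup (X ∘ Y) e ≡ lookup Y e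
lookup-∘-zeroˡ {e = e} X Y Xe≡0 = trans (lookup-∘ X Y e) (cong (_∘s lookup Y e) Xe≡0)

lookup-∘-nonzeroˡ : ∀ (X Y : SignVec n) → lookup X e ≢ zer → lookup (X ∘ Y) e ≡ lookup X e
lookup-∘-nonzeroˡ {e = e} X Y Xe≢0 = trans (lookup-∘ X Y e) (∘ˢ-nonzeroˡ Xe≢0)

lookup-∘-≡ˡ : ∀ (X Y : SignVec n) → lookup X e ≡ t → t ≢ zer → lookup (X ∘ Y) e ≡ t
lookup-∘-≡ˡ X Y Xe≡t t≢0 = trans (lookup-∘-nonzeroˡ X Y (subst (_≢ zer) (sym Xe≡t) t≢0)) Xe≡t

lookup-∘-zeroʳ : ∀ (X Y : SignVec n) → lookup Y e ≡ zer → lookup (X ∘ Y) e ≡ lookup X e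
lookup-∘-zeroʳ {e = e} X Y Ye≡0 =
  trans (lookup-∘ X Y e) (trans (cong (lookup X e ∘s_) Ye≡0) ∘ˢ-identityʳ)

lookup-neg : ∀ (X : SignVec n) e → lookup (- X) e ≡ opp (lookup X e)
lookup-neg X e = lookup-map e opp X

lookup-𝟎 : ∀ (e : Fin n) → lookup 𝟎 e ≡ zer
lookup-𝟎 e = lookup-replicate e zer

lookup-extensionality : (∀ e → lookup X e ≡ lookup Y e) → X ≡ Y
lookup-extensionality {X = X} {Y = Y} X≗Y =
  trans (sym (tabulate∘lookup X)) (trans (tabulate-cong X≗Y) (tabulate∘lookup Y))

≤-∘ : ∀ (X Y : SignVec n) → X ≤ (X ∘ Y)
≤-∘ X Y e = subst (lookup X e ≤s_) (sym (lookup-∘ X Y e)) ≤ˢ-∘ˢ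

Full : SignVec n → Set
Full X = ∀ e → lookup X e ≢ zer

full-∘ : ∀ (X Y : SignVec n) → Full Y → Full (X ∘ Y)
full-∘ X Y FY e XYe≡0 = ∘ˢ≢zer {x = lookup X e} (FY e) (trans (sym (lookup-∘ X Y e)) XYe≡0)

full-neg : ∀ (X : SignVec n) → Full X → Full (- X)
full-neg X FX e -Xe≡0 = opp≢zer (FX e) (trans (sym (lookup-neg X e)) -Xe≡0)

data _≡±_ (P X : SignVec n) : Set where
  same     : (∀ e → lookup P e ≡ lookup X e) → P ≡± X
  opposite : (∀ e → lookup P e ≡ opp (lookup X e)) → P ≡± X

≡±-zero : ∀ {P} → P ≡± X → lookup X e ≡ zer → lookup P e ≡ zer
≡±-zero {e = e} (same P≗X) Xe≡0 = trans (P≗X e) Xe≡0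
≡±-zero {e = e} (opposite P≗-X) Xe≡0 = trans (P≗-X e) (cong opp Xe≡0)

≡±-· : ∀ {P} → P ≡± X → lookup P e · lookup P f ≡ lookup X e · lookup X f
≡±-· {X = X} {e = e} {f = f} {P = P} (same P≗X) =
  trans (cong (_· lookup P f) (P≗X e)) (cong (lookup X e ·_) (P≗X f))
≡±-· {X = X} {e = e} {f = f} {P = P} (opposite P≗-X) =
  trans (cong (_· lookup P f) (P≗-X e)) (trans (cong (opp (lookup X e) ·_) (P≗-X f)) opp-·-opp)

¬InSep-zeroʳ : ∀ (X Y : SignVec n) → lookup Y e ≡ zer → ¬ InSep X Y e
¬InSep-zeroʳ _ _ Ye≡0 (Xe≢0 , Xe≡-Ye) = Xe≢0 (trans Xe≡-Ye (cong opp Ye≡0))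

¬InSep-equal : ∀ (X Y : SignVec n) → lookup X e ≡ lookup Y e → ¬ InSep X Y e
¬InSep-equal _ _ Xe≡Ye (Xe≢0 , Xe≡-Ye) = ≢opp Xe≢0 (trans Xe≡-Ye (cong opp (sym Xe≡Ye)))

separated : ∀ (X Y : SignVec n) → lookup X e ≢ zer → lookup Y e ≢ zer → lookup X e ≢ lookup Y e →
            InSep X Y e
separated _ _ Xe≢0 Ye≢0 Xe≢Ye with align Ye≢0 Xe≢0
... | inj₁ Ye≡Xe = contradiction (sym Ye≡Xe) Xe≢Ye
... | inj₂ -Ye≡Xe = Xe≢0 , sym -Ye≡Xe

differ : SignVec n → SignVec n → Subset n
differ X Y = tabulate λ e → isNo (lookup X e ≟ˢ lookup Y e)

∈-differ⁺ : ∀ X Y → lookup X e ≢ lookup Y e → e ∈ differ {n} X Y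
∈-differ⁺ {e = e} X Y Xe≢Ye =
  lookup⇒[]= e (differ X Y) (trans (lookup∘tabulate _ e) isNo≡true)
  where
  isNo≡true : isNo (lookup X e ≟ˢ lookup Y e) ≡ true
  isNo≡true with lookup X e ≟ˢ lookup Y e
  ... | yes Xe≡Ye = contradiction Xe≡Ye Xe≢Ye
  ... | no _ = refl

∈-differ⁻ : ∀ X Y → e ∈ differ {n} X Y → lookup X e ≢ lookup Y e
∈-differ⁻ {e = e} X Y e∈ with lookup X e ≟ˢ lookup Y e
  | trans (sym (lookup∘tabulate (λ e → isNo (lookup X e ≟ˢ lookup Y e)) e)) ([]=⇒lookup e∈)
... | yes _ | ()
... | no Xe≢Ye | _ = Xe≢Ye

agree-or-differ : ∀ (X Y : SignVec n) → (∀ e → lookup X e ≡ lookup Y e) ⊎ Nonempty (differ X Y)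
agree-or-differ {n} X Y with all? (λ e → lookup X e ≟ˢ lookup Y e)
... | yes X≗Y = inj₁ X≗Y
... | no X≉Y =
  let e , Xe≢Ye = ¬∀⟶∃¬ n _ (λ e → lookup X e ≟ˢ lookup Y e) X≉Y in inj₂ (e , ∈-differ⁺ X Y Xe≢Ye)

differ-⊂ : ∀ X Y Z {a} → (∀ f → lookup X f ≡ lookup Y f → lookup Z f ≡ lookup X f) →
           lookup X a ≢ lookup Y a → lookup Z a ≡ lookup X a → differ {n} X Z ⊂ differ X Y
differ-⊂ X Y Z {a} Z-keeps Xa≢Ya Za≡Xa =
  narrower , a , ∈-differ⁺ X Y Xa≢Ya , λ a∈ → ∈-differ⁻ X Z a∈ (sym Za≡Xa)
  where
  narrower : differ X Z ⊆ differ X Y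
  narrower {f} f∈ = ∈-differ⁺ X Y λ Xf≡Yf → ∈-differ⁻ X Z f∈ (sym (Z-keeps f Xf≡Yf))

<⇒new-support : X < Y → ∃ λ e → lookup X e ≡ zer × lookup Y e ≢ zer
<⇒new-support {X = X} {Y = Y} (X≤Y , X≢Y) with agree-or-differ X Y
... | inj₁ X≗Y = contradiction (lookup-extensionality X≗Y) X≢Y
... | inj₂ (e , e∈) =
  let Xe≢Ye = ∈-differ⁻ X Y e∈
      Xe≡0 = ≤ˢ-≢ (X≤Y e) Xe≢Ye
  in e , Xe≡0 , λ Ye≡0 → Xe≢Ye (trans Xe≡0 (sym Ye≡0))

x∉p⇒∣p∪⁅x⁆∣≡1+∣p∣ : ∀ {p : Subset n} {x} → x ∉ p → ∣ p ∪ ⁅ x ⁆ ∣ ≡ suc ∣ p ∣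
x∉p⇒∣p∪⁅x⁆∣≡1+∣p∣ {p = outside ∷ p} {zero} _ = cong (λ q → suc ∣ q ∣) (∪-identityʳ p)
x∉p⇒∣p∪⁅x⁆∣≡1+∣p∣ {p = inside ∷ p} {zero} x∉p = contradiction here x∉p
x∉p⇒∣p∪⁅x⁆∣≡1+∣p∣ {p = outside ∷ p} {suc x} x∉p = x∉p⇒∣p∪⁅x⁆∣≡1+∣p∣ λ x∈p → x∉p (there x∈p)
x∉p⇒∣p∪⁅x⁆∣≡1+∣p∣ {p = inside ∷ p} {suc x} x∉p = cong suc (x∉p⇒∣p∪⁅x⁆∣≡1+∣p∣ λ x∈p → x∉p (there x∈p))

module OrientedMatroid {n} {L : SignVec n → Set} (om : IsOM n L) where
  open IsOM om

  full⇒tope : L X → Full X → IsTope L X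
  full⇒tope LX FX = LX , λ Y _ X≤Y → lookup-extensionality λ e → ≤ˢ-nonzero (FX e) (X≤Y e)

  tope⇒full : IsTope L X → Full X
  tope⇒full {X = X} (LX , maximal) e Xe≡0 with allValues e pos
  ... | W , LW , We≡pos = pos≢zer (begin
    pos                 ≡⟨ sym We≡pos ⟩
    lookup W e          ≡⟨ sym (lookup-∘-zeroˡ X W Xe≡0) ⟩
    lookup (X ∘ W) e    ≡⟨ cong (λ V → lookup V e) (maximal (X ∘ W) (comp∈ X W LX LW) (≤-∘ X W)) ⟩
    lookup X e          ≡⟨ Xe≡0 ⟩
    zer                 ∎)
    where
    open ≡-Reasoning
    pos≢zer : pos ≢ zer
    pos≢zer ()

  orient : L X → ∀ {a} → lookup X a ≢ zer → t ≢ zer → ∃ λ P → L P × P ≡± X × lookup P a ≡ t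
  orient {X = X} LX {a} Xa≢0 t≢0 with align Xa≢0 t≢0
  ... | inj₁ Xa≡t = X , LX , same (λ _ → refl) , Xa≡t
  ... | inj₂ -Xa≡t = - X , neg∈ X LX , opposite (lookup-neg X) , trans (lookup-neg X a) -Xa≡t

  -- Eliminate b between Y and ±P oriented against Y at b: the zeros of P lie outside the
  -- separation set, so there the eliminant keeps the value of Y.
  eliminate : L Y → ∀ {P b} → L P → lookup P b ≢ zer →
              ∃ λ Z → L Z × lookup Z b ≡ zer × (∀ f → lookup P f ≡ zer → lookup Z f ≡ lookup Y f)
  eliminate {Y = Y} LY {P} {b} LP Pb≢0 with lookup Y b ≟ˢ zer
  ... | yes Yb≡0 = Y , LY , Yb≡0 , λ _ _ → refl
  ... | no Yb≢0 with orient LP Pb≢0 (opp≢zer Yb≢0)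
  ...   | P' , LP' , P'≡±P , P'b≡-Yb
    with strongElim Y P' LY LP' b (Yb≢0 , sym (trans (cong opp P'b≡-Yb) opp-involutive))
  ...   | Z , LZ , Zb≡0 , Z-outside-Sep = Z , LZ , Zb≡0 , keeps
    where
    keeps : ∀ f → lookup P f ≡ zer → lookup Z f ≡ lookup Y f
    keeps f Pf≡0 =
      let P'f≡0 = ≡±-zero P'≡±P Pf≡0
      in trans (Z-outside-Sep f (¬InSep-zeroʳ Y P' P'f≡0)) (lookup-∘-zeroʳ Y P' P'f≡0)

  realize-product : ∀ {a c} → a ≢ c → ∀ u → u ≢ zer → ∃ λ W → L W × lookup W a · lookup W c ≡ u
  realize-product a≢c pos _ = let X , _ , LX , _ , Xac≡pos , _ = distinct _ _ a≢c in X , LX , Xac≡pos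
  realize-product a≢c neg _ = let _ , Y , _ , LY , _ , Yac≡neg = distinct _ _ a≢c in Y , LY , Yac≡neg
  realize-product a≢c zer u≢0 = contradiction refl u≢0

  realize-pair : ∀ {a c s} → a ≢ c → s ≢ zer → t ≢ zer → ∃ λ V → L V × lookup V a ≡ s × lookup V c ≡ t
  realize-pair {t} {a} {c} {s} a≢c s≢0 t≢0 with realize-product a≢c (s · t) (·≢zer s≢0 t≢0)
  ... | W , LW , Wac≡st with orient LW (·≢zerˡ (subst (_≢ zer) (sym Wac≡st) (·≢zer s≢0 t≢0))) s≢0
  ... | V , LV , V≡±W , Va≡s = V , LV , Va≡s , ·-cancelˡ s≢0 (begin
    s · lookup V c             ≡⟨ cong (_· lookup V c) (sym Va≡s) ⟩
    lookup V a · lookup V c    ≡⟨ ≡±-· V≡±W ⟩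
    lookup W a · lookup W c    ≡⟨ Wac≡st ⟩
    s · t                      ∎)
    where open ≡-Reasoning

  record Triangular (m : ℕ) : Set where
    field
      member       : Fin m → SignVec n
      pivot        : Fin m → Fin n
      member∈L     : ∀ i → L (member i)
      pivot≢zer    : ∀ i → lookup (member i) (pivot i) ≢ zer
      vanish-later : ∀ {i j} → i <ᶠ j → lookup (member i) (pivot j) ≡ zer

  open Triangular

  Vanishes : ∀ {m} → Triangular m → Fin n → Set
  Vanishes F f = ∀ i → lookup (member F i) f ≡ zer

  empty : Triangular 0
  empty = record
    { member = λ () ; pivot = λ () ; member∈L = λ () ; pivot≢zer = λ () ; vanish-later = λ { {()} } }

  cons : ∀ {m a} → L Y → lookup Y a ≢ zer → (F : Triangular m) → (∀ j → lookup Y (pivot F j) ≡ zer) →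
         Triangular (suc m)
  cons {Y = Y} {a = a} LY Ya≢0 F Y-vanishes = record
    { member = Y Vector.∷ member F
    ; pivot = a Vector.∷ pivot F
    ; member∈L = λ { zero → LY ; (suc i) → member∈L F i }
    ; pivot≢zer = λ { zero → Ya≢0 ; (suc i) → pivot≢zer F i }
    ; vanish-later = later
    }
    where
    later : ∀ {i j} → i <ᶠ j → lookup ((Y Vector.∷ member F) i) ((a Vector.∷ pivot F) j) ≡ zer
    later {zero} {suc j} _ = Y-vanishes j
    later {suc i} {suc j} (s<s i<j) = vanish-later F i<j

  -- The last element of the chain may be 1̂.
  chain-tail⇒triangular : ∀ {X} rest → Linked (_<̂_ L) (just X ∷ rest) → All (InPoset L) rest →
    Σ (Triangular (length rest ∸ 1)) λ F → ∀ j → lookup X (pivot F j) ≡ zer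
  chain-tail⇒triangular [] _ _ = empty , λ ()
  chain-tail⇒triangular (_ ∷ []) _ _ = empty , λ ()
  chain-tail⇒triangular (nothing ∷ _ ∷ _) (_ ∷ () ∷ _) _
  chain-tail⇒triangular {X} (just Y ∷ rest@(_ ∷ _)) (X<Y ∷ linked) (LY ∷ all)
    with chain-tail⇒triangular rest linked all | <⇒new-support X<Y
  ... | F , Y-vanishes | a , Xa≡0 , Ya≢0 = cons LY Ya≢0 F Y-vanishes , X-vanishes
    where
    X-vanishes : ∀ j → lookup X ((a Vector.∷ pivot F) j) ≡ zer
    X-vanishes zero = Xa≡0
    X-vanishes (suc j) = ≤ˢ-zero (proj₁ X<Y (pivot F j)) (Y-vanishes j)

  chain⇒triangular : ∀ c → IsChain L c → Triangular (length c ∸ 1 ∸ 1)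
  chain⇒triangular [] _ = empty
  chain⇒triangular (nothing ∷ []) _ = empty
  chain⇒triangular (nothing ∷ _ ∷ _) (_ , () ∷ _)
  chain⇒triangular (just _ ∷ rest) (_ ∷ all , linked) = proj₁ (chain-tail⇒triangular rest linked all)

  eliminate-by-head : ∀ {m} (F : Triangular (suc m)) {b} → lookup (member F zero) b ≢ zer →
    Σ (Triangular m) λ F' → Vanishes F' b × (∀ {f} → Vanishes F f → Vanishes F' f)
  eliminate-by-head {m} F {b} Y₀b≢0 = F' , (λ i → proj₁ (proj₂ (proj₂ (eliminated i)))) , vanishes
    where
    eliminated : ∀ (i : Fin m) → ∃ λ Z → L Z × lookup Z b ≡ zer ×
                   (∀ f → lookup (member F zero) f ≡ zer → lookup Z f ≡ lookup (member F (suc i)) f)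
    eliminated i = eliminate (member∈L F (suc i)) (member∈L F zero) Y₀b≢0

    keeps : ∀ i f → lookup (member F zero) f ≡ zer →
            lookup (proj₁ (eliminated i)) f ≡ lookup (member F (suc i)) f
    keeps i = proj₂ (proj₂ (proj₂ (eliminated i)))

    F' : Triangular m
    F' = record
      { member = λ i → proj₁ (eliminated i)
      ; pivot = λ i → pivot F (suc i)
      ; member∈L = λ i → proj₁ (proj₂ (eliminated i))
      ; pivot≢zer = λ i → subst (_≢ zer) (sym (keeps i _ (vanish-later F z<s))) (pivot≢zer F (suc i))
      ; vanish-later = λ i<j → trans (keeps _ _ (vanish-later F z<s)) (vanish-later F (s<s i<j))
      }

    vanishes : ∀ {f} → Vanishes F f → Vanishes F' f
    vanishes F-vanishes i = trans (keeps i _ (F-vanishes zero)) (F-vanishes (suc i))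

  record ShatteredVanishingOn (Zero : Fin n → Set) (D : Subset n) : Set where
    constructor shattering
    field
      realize : ∀ (σ : Fin n → Bool) →
        ∃ λ C → L C × (∀ f → Zero f → lookup C f ≡ zer) × (∀ e → e ∈ D → lookup C e ≡ toSign L (σ e))

  open ShatteredVanishingOn

  toSign≢zer : ∀ s → toSign L s ≢ zer
  toSign≢zer true ()
  toSign≢zer false ()

  shattered-∅ : ∀ {Zero} → ShatteredVanishingOn Zero ∅
  shattered-∅ = shattering λ _ → 𝟎 , zero∈ , (λ f _ → lookup-𝟎 f) , λ e e∈ → contradiction e∈ ∉⊥

  shattered-disjoint : ∀ {Zero D} → ShatteredVanishingOn Zero D → e ∈ D → ¬ Zero e
  shattered-disjoint {e = e} shattered e∈D Zero-e =
    let _ , _ , C-vanishes , C-realizes = realize shattered (λ _ → true)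
    in toSign≢zer true (trans (sym (C-realizes e e∈D)) (C-vanishes e Zero-e))

  shattered-extend : ∀ {Zero Zero' D b} → ShatteredVanishingOn Zero' D → Zero' b →
    L Y → lookup Y b ≢ zer → (∀ {f} → Zero f → Zero' f × lookup Y f ≡ zer) →
    ShatteredVanishingOn Zero (D ∪ ⁅ b ⁆)
  shattered-extend {Y = Y} {Zero} {Zero'} {D} {b} shattered Zero'-b LY Yb≢0 Zero⊆ = shattering realize-∪
    where
    realize-∪ : ∀ σ → ∃ λ C → L C × (∀ f → Zero f → lookup C f ≡ zer) ×
                              (∀ e → e ∈ D ∪ ⁅ b ⁆ → lookup C e ≡ toSign L (σ e))
    realize-∪ σ with realize shattered σ | orient LY Yb≢0 (toSign≢zer (σ b))
    ... | C , LC , C-vanishes , C-realizes | P , LP , P≡±Y , Pb≡σb =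
      C ∘ P , comp∈ C P LC LP , vanishes , realizes
      where
      vanishes : ∀ f → Zero f → lookup (C ∘ P) f ≡ zer
      vanishes f Zero-f = let Zero'-f , Yf≡0 = Zero⊆ Zero-f in
        trans (lookup-∘-zeroˡ C P (C-vanishes f Zero'-f)) (≡±-zero P≡±Y Yf≡0)
      realizes : ∀ e → e ∈ D ∪ ⁅ b ⁆ → lookup (C ∘ P) e ≡ toSign L (σ e)
      realizes e e∈ with x∈p∪q⁻ D ⁅ b ⁆ e∈
      ... | inj₁ e∈D = lookup-∘-≡ˡ C P (C-realizes e e∈D) (toSign≢zer (σ e))
      ... | inj₂ e∈⁅b⁆ rewrite x∈⁅y⁆⇒x≡y b e∈⁅b⁆ = trans (lookup-∘-zeroˡ C P (C-vanishes b Zero'-b)) Pb≡σb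

  module _ {T} (T-tope : IsTope L T) where
    private
      LT : L T
      LT = proj₁ T-tope
      T-full : Full T
      T-full = tope⇒full T-tope

    adjacent-across : ∀ {b} → L Z → lookup Z b ≡ zer → (∀ f → f ≢ b → lookup Z f ≡ lookup T f) →
                      InOsc L T b
    adjacent-across {Z = Z} {b} LZ Zb≡0 Z≈T =
      Z ∘ (- T) , full⇒tope (comp∈ Z (- T) LZ (neg∈ T LT)) (full-∘ Z (- T) (full-neg T T-full)) ,
      flips , agrees
      where
      flips : lookup T b ≢ lookup (Z ∘ (- T)) b
      flips Tb≡ = ≢opp (T-full b) (trans Tb≡ (trans (lookup-∘-zeroˡ Z (- T) Zb≡0) (lookup-neg T b)))
      agrees : ∀ f → f ≢ b → lookup T f ≡ lookup (Z ∘ (- T)) f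
      agrees f f≢b = sym (lookup-∘-≡ˡ Z (- T) (Z≈T f f≢b) (T-full f))

    -- Induction on the separation set of T and S: each step replaces S by a tope that agrees
    -- with T wherever S does and also at one more coordinate.
    towards : ∀ {S} → L S → Full S → Acc _⊂_ (differ T S) → Nonempty (differ T S) →
              ∃ λ b → b ∈ differ T S × InOsc L T b
    towards {S} LS S-full (acc smaller) (a , a∈)
      with strongElim T S LT LS a (separated T S (T-full a) (S-full a) (∈-differ⁻ T S a∈))
    ... | Z , LZ , Za≡0 , Z-outside-Sep = case-split (agree-or-differ T (Z ∘ T))
      where
      Z-keeps : ∀ f → lookup T f ≡ lookup S f → lookup Z f ≡ lookup T f
      Z-keeps f Tf≡Sf =
        trans (Z-outside-Sep f (¬InSep-equal T S Tf≡Sf)) (lookup-∘-nonzeroˡ T S (T-full f))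

      descend : ∀ W → L W → Full W → lookup W a ≡ lookup T a → Nonempty (differ T (Z ∘ W)) →
                ∃ λ b → b ∈ differ T S × InOsc L T b
      descend W LW W-full Wa≡Ta ZW≠T =
        let ZW⊂S = differ-⊂ T S (Z ∘ W) (λ f Tf≡Sf → lookup-∘-≡ˡ Z W (Z-keeps f Tf≡Sf) (T-full f))
                     (∈-differ⁻ T S a∈) (trans (lookup-∘-zeroˡ Z W Za≡0) Wa≡Ta)
            b , b∈ , b-osc = towards (comp∈ Z W LZ LW) (full-∘ Z W W-full) (smaller ZW⊂S) ZW≠T
        in b , proj₁ ZW⊂S b∈ , b-osc

      -- If Z ∘ T = T, then T is adjacent across a unless Z has a second zero c; a covector V
      -- with V_a = T_a and V_c = - T_c then moves Z ∘ V ∘ T off T at c but not at a.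
      case-split : (∀ f → lookup T f ≡ lookup (Z ∘ T) f) ⊎ Nonempty (differ T (Z ∘ T)) →
                   ∃ λ b → b ∈ differ T S × InOsc L T b
      case-split (inj₂ ZT≠T) = descend T LT T-full refl ZT≠T
      case-split (inj₁ T≗ZT) with any? (λ c → ¬? (c ≟ᶠ a) ×-dec (lookup Z c ≟ˢ zer))
      ... | no no-other-zero = a , a∈ , adjacent-across LZ Za≡0 Z≈T
        where
        Z≈T : ∀ f → f ≢ a → lookup Z f ≡ lookup T f
        Z≈T f f≢a with lookup Z f ≟ˢ zer
        ... | yes Zf≡0 = contradiction (f , f≢a , Zf≡0) no-other-zero
        ... | no Zf≢0 = trans (sym (lookup-∘-nonzeroˡ Z T Zf≢0)) (sym (T≗ZT f))
      ... | yes (c , c≢a , Zc≡0)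
        with realize-pair (λ a≡c → c≢a (sym a≡c)) (T-full a) (opp≢zer (T-full c))
      ...   | V , LV , Va≡Ta , Vc≡-Tc =
        descend (V ∘ T) (comp∈ V T LV LT) (full-∘ V T T-full) (lookup-∘-≡ˡ V T Va≡Ta (T-full a))
          (c , ∈-differ⁺ T (Z ∘ (V ∘ T)) Tc≢ZVTc)
        where
        Tc≢ZVTc : lookup T c ≢ lookup (Z ∘ (V ∘ T)) c
        Tc≢ZVTc Tc≡ZVTc = ≢opp (T-full c) (begin
          lookup T c                ≡⟨ Tc≡ZVTc ⟩
          lookup (Z ∘ (V ∘ T)) c    ≡⟨ lookup-∘-zeroˡ Z (V ∘ T) Zc≡0 ⟩
          lookup (V ∘ T) c          ≡⟨ lookup-∘-≡ˡ V T Vc≡-Tc (opp≢zer (T-full c)) ⟩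
          opp (lookup T c)          ∎)
          where open ≡-Reasoning

    support-meets-osc : L X → ∀ {a} → lookup X a ≢ zer → ∃ λ b → lookup X b ≢ zer × InOsc L T b
    support-meets-osc {X = X} LX {a} Xa≢0 with orient LX Xa≢0 (opp≢zer (T-full a))
    ... | P , LP , P≡±X , Pa≡-Ta =
      let b , b∈ , b-osc = towards (comp∈ P T LP LT) (full-∘ P T T-full) (⊂-wellFounded _)
                                   (a , ∈-differ⁺ T (P ∘ T) Ta≢PTa)
      in b , (λ Xb≡0 → ∈-differ⁻ T (P ∘ T) b∈ (sym (lookup-∘-zeroˡ P T (≡±-zero P≡±X Xb≡0)))) , b-osc
      where
      Ta≢PTa : lookup T a ≢ lookup (P ∘ T) a
      Ta≢PTa Ta≡PTa = ≢opp (T-full a) (trans Ta≡PTa (lookup-∘-≡ˡ P T Pa≡-Ta (opp≢zer (T-full a))))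

    record OscShattered (Zero : Fin n → Set) (m : ℕ) : Set where
      field
        D         : Subset n
        D⊆osc     : ∀ e → e ∈ D → InOsc L T e
        ∣D∣≡m     : ∣ D ∣ ≡ m
        shattered : ShatteredVanishingOn Zero D

    open OscShattered

    osc-shattered-∅ : ∀ {Zero} → OscShattered Zero 0
    osc-shattered-∅ = record
      { D = ∅ ; D⊆osc = λ _ e∈ → contradiction e∈ ∉⊥ ; ∣D∣≡m = ∣⊥∣≡0 n ; shattered = shattered-∅ }

    osc-shattered-insert : ∀ {Zero Zero' m b} → OscShattered Zero' m → InOsc L T b → Zero' b →
      L Y → lookup Y b ≢ zer → (∀ {f} → Zero f → Zero' f × lookup Y f ≡ zer) → OscShattered Zero (suc m)
    osc-shattered-insert {b = b} S b-osc Zero'-b LY Yb≢0 Zero⊆ = record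
      { D = D S ∪ ⁅ b ⁆
      ; D⊆osc = λ e e∈ → [ D⊆osc S e , (λ e∈⁅b⁆ → subst (InOsc L T) (sym (x∈⁅y⁆⇒x≡y b e∈⁅b⁆)) b-osc) ]′
                           (x∈p∪q⁻ (D S) ⁅ b ⁆ e∈)
      ; ∣D∣≡m = trans (x∉p⇒∣p∪⁅x⁆∣≡1+∣p∣ λ b∈D → shattered-disjoint (shattered S) b∈D Zero'-b)
                      (cong suc (∣D∣≡m S))
      ; shattered = shattered-extend (shattered S) Zero'-b LY Yb≢0 Zero⊆
      }

    triangular⇒osc-shattered : ∀ {m} (F : Triangular m) → OscShattered (Vanishes F) m
    triangular⇒osc-shattered {zero} F = osc-shattered-∅
    triangular⇒osc-shattered {suc m} F =
      let b , Y₀b≢0 , b-osc = support-meets-osc (member∈L F zero) (pivot≢zer F zero)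
          F' , F'-vanishes-at-b , F'-vanishes = eliminate-by-head F Y₀b≢0
      in osc-shattered-insert (triangular⇒osc-shattered F') b-osc F'-vanishes-at-b (member∈L F zero) Y₀b≢0
           (λ F-vanishes → F'-vanishes F-vanishes , F-vanishes zero)

    shattered-by-topes : ∀ {Zero D} → ShatteredVanishingOn Zero D → Shattered L D
    shattered-by-topes shattered σ =
      let C , LC , _ , C-realizes = realize shattered σ in
      C ∘ T , full⇒tope (comp∈ C T LC LT) (full-∘ C T T-full) ,
      λ e e∈D → lookup-∘-≡ˡ C T (C-realizes e e∈D) (toSign≢zer (σ e))

lemma15 : (n : ℕ) (L : SignVec n → Set) → IsOM n L → (d : ℕ) → HasRank L d →
    (T : SignVec n) → IsTope L T →
    Σ (Subset n) λ D → (∀ e → e ∈ D → InOsc L T e) × (∣ D ∣ ≡ d) × Shattered L D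
lemma15 n L om d (c , (chain , _) , ∣c∣∸2≡d) T T-tope =
  D S , D⊆osc S , trans (∣D∣≡m S) ∣c∣∸2≡d , shattered-by-topes T-tope (shattered S)
  where
  open OrientedMatroid om
  open OscShattered
  S : OscShattered T-tope (Vanishes (chain⇒triangular c chain)) (length c ∸ 1 ∸ 1)
  S = triangular⇒osc-shattered T-tope (chain⇒triangular c chain)
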